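{- Let $G$ be a graph, $A\subseteq V(G)$, and $t\in V(G)$ such that $\rho_G(A\cup\{t\})=\rho_G(A)$. Then $A\cup\{t\}$ is sequential in $G$ if and only if $A$ is sequential in $G$.
   Context: Graphs are finite and simple. The cut-rank $\rho_G(X)$ of $X\subseteq V(G)$ is the $\mathrm{GF}(2)$-rank of the $X\times(V(G)-X)$ submatrix of the adjacency matrix. A set $A\subseteq V(G)$ is sequential in $G$ if there is an ordering $a_1,\dots,a_{|A|}$ of $A$ with $\rho_G(\{a_1,\dots,a_i\})\le 2$ for each $1\le i\le |A|$. -}

module Defs where

open import Data.Nat using (ℕ; zero; suc; _≤_)
open import Data.Bool using (Bool; true; false; not; _xor_; if_then_else_)
open import Data.Fin using (Fin)
open import Data.Fin.Subset using (Subset; _∈_)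
open import Data.Maybe using (Maybe; just; nothing)
open import Data.Vec as Vec using (Vec; []; _∷_; lookup; zipWith)
open import Data.List as List using (List; []; _∷_; _++_; length; map; filterᵇ; allFin; take)
open import Data.List.Relation.Unary.Unique.Propositional using (Unique)
import Data.List.Membership.Propositional as LM
open import Data.Product using (Σ; _×_; _,_)
open import Function.Bundles using (_⇔_)
open import Relation.Binary.PropositionalEquality using (_≡_)

record Graph (n : ℕ) : Set where
  field
    adj       : Fin n → Fin n → Bool
    symmetric : ∀ i j → adj i j ≡ adj j i
    loopless  : ∀ i → adj i i ≡ false
open Graph public

pickPivot : ∀ {m} → List (Vec Bool (suc m)) → Maybe (Vec Bool m × List (Vec Bool (suc m)))
pickPivot [] = nothing
pickPivot ((true ∷ r) ∷ rs) = just (r , rs)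
pickPivot ((false ∷ r) ∷ rs) with pickPivot rs
... | nothing = nothing
... | just (p , rs') = just (p , (false ∷ r) ∷ rs')

reduce : ∀ {m} → Vec Bool m → Vec Bool (suc m) → Vec Bool m
reduce p (b ∷ r) = if b then zipWith _xor_ p r else r

rank : ∀ m → List (Vec Bool m) → ℕ
rank zero    rows = 0
rank (suc m) rows with pickPivot rows
... | nothing        = rank m (map Vec.tail rows)
... | just (p , rs)  = suc (rank m (map (reduce p) rs))

inside : ∀ {n} → Subset n → List (Fin n)
inside X = filterᵇ (λ j → lookup X j) (allFin _)

outside : ∀ {n} → Subset n → List (Fin n)
outside X = filterᵇ (λ j → not (lookup X j)) (allFin _)

cutMatrix : ∀ {n} → Graph n → (X : Subset n) → List (Vec Bool (length (outside X)))
cutMatrix G X = map (λ i → Vec.map (adj G i) (Vec.fromList (outside X))) (inside X)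

cutRank : ∀ {n} → Graph n → Subset n → ℕ
cutRank G X = rank (length (outside X)) (cutMatrix G X)

toSubset : ∀ {n} → List (Fin n) → Subset n
toSubset [] = Vec.replicate _ false
toSubset (x ∷ xs) = Vec.updateAt (toSubset xs) x (λ _ → true)

Sequential : ∀ {n} → Graph n → Subset n → Set
Sequential {n} G A =
  Σ (List (Fin n)) λ as →
    Unique as
    × (∀ x → (x LM.∈ as) ⇔ (x ∈ A))
    × (∀ i → 1 ≤ i → i ≤ length as → cutRank G (toSubset (take i as)) ≤ 2)

-- Write M for the adjacency matrix over GF(2) and M[R, C] for its submatrices, so that ρ(X) = rk M[X, V − X].
-- The heart of the matter is that ρ(Y) ≤ ρ(Y ∪ {t}) for every Y ⊆ A when t ∉ A and ρ(A ∪ {t}) = ρ(A).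
-- Put Z = V − Y − t; then ρ(Y ∪ {t}) = rk M[Y + t, Z] and, M being symmetric, ρ(Y) = rk M[Z + t, Y].
-- If row t of M[Y + t, Z] is not spanned by the rows of Y, then ρ(Y ∪ {t}) = rk M[Y, Z] + 1 ≥ ρ(Y), as one more
-- row raises the rank by at most one. Otherwise it stays spanned on rows A and columns V − A − t, so that
-- rk M[V − A − t + t, A] = ρ(A) = ρ(A ∪ {t}) = rk M[A, V − A − t]: now row t of M[V − A − t + t, A] is spanned,
-- hence also on rows Z and columns Y, and ρ(Y) = rk M[Z, Y] = ρ(Y ∪ {t}).
-- So deleting t from a witnessing ordering of A ∪ {t} keeps every prefix of cut-rank at most 2, while appending t
-- to one of A only adds the prefix A ∪ {t}, of cut-rank ρ(A) ≤ 2.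
--
-- Rank is computed by Gaussian elimination. It depends only on the span of the rows, and it is the
-- least k such that the matrix factors as U Wᵀ through GF(2)ᵏ; this gives invariance under transposition and
-- monotonicity under passing to submatrices.

module Submission where

open import Defs
open import Data.Nat using (ℕ; zero; suc; _+_; _≤_; z≤n; s≤s; _≤?_)
open import Data.Nat.Properties using (≤-refl; ≤-trans; ≤-antisym; ≤-reflexive; n≤1+n; 1+n≢n; ≰⇒>; +-comm; module ≤-Reasoning)
open import Data.Fin as Fin using (Fin; _≟_)
open import Data.Fin.Subset using (Subset; _∪_; ⁅_⁆; _∈_; _∉_; _⊆_)
open import Data.Fin.Subset.Properties using (_∈?_; x∈p∪q⁻; x∈p∪q⁺; x∈⁅x⁆; x∈⁅y⁆⇒x≡y; ∉⊥; ⊆-antisym; ∪-identityʳ)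
open import Data.Bool using (Bool; true; false; not; _xor_; _∧_)
open import Data.Bool.Properties
  using (xor-assoc; xor-comm; xor-identityˡ; xor-identityʳ; xor-same; ∧-comm; ∨-zeroʳ; ∨-identityʳ; T-≡; T-not-≡; not-¬; ¬-not)
open import Data.Vec as Vec using (Vec; []; _∷_; zipWith; replicate)
open import Data.Vec.Properties
  using (zipWith-assoc; zipWith-comm; zipWith-identityˡ; zipWith-identityʳ; lookup-zipWith; lookup-replicate; []=⇒lookup; lookup⇒[]=)
  renaming (map-cong to Vec-map-cong)
open import Data.List as List using (List; []; _∷_; _++_; [_]; length; map)
open import Data.List.Properties using (map-++; map-∘; map-cong; ++-assoc; ++-identityʳ; take-all; length-++; length-++-sucʳ)
open import Data.List.Relation.Unary.Any as Any using (here; there)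
open import Data.List.Relation.Unary.All as All using (All; []; _∷_)
open import Data.List.Relation.Unary.AllPairs using ([]; _∷_)
open import Data.List.Relation.Unary.Unique.Propositional using (Unique)
open import Data.List.Relation.Unary.Unique.Propositional.Properties using () renaming (++⁺ to Unique-++⁺)
open import Data.List.Membership.Propositional using () renaming (_∈_ to _∈ₗ_)
open import Data.List.Membership.Propositional.Properties
  using (∈-++⁺ˡ; ∈-++⁺ʳ; ∈-++⁻; ∈-∃++; ∈-map⁺; ∈-map⁻; ∈-filter⁺; ∈-filter⁻; ∈-allFin)
open import Data.List.Relation.Binary.Subset.Propositional using () renaming (_⊆_ to _⊆ₗ_)
open import Data.List.Relation.Binary.Subset.Propositional.Properties using (⊆-reflexive-↭; xs⊆xs++ys; xs⊆ys++xs; map⁺)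
open import Data.List.Relation.Binary.Permutation.Propositional using (_↭_; ↭-refl; ↭-sym; ↭-trans; ↭-prep; ↭-swap)
open import Data.List.Relation.Binary.Permutation.Propositional.Properties using (∷↭∷ʳ; shift; All-resp-↭; ∈-resp-↭)
open import Data.Product using (Σ; _×_; _,_; proj₁; proj₂)
open import Data.Sum as Sum using (_⊎_; inj₁; inj₂; [_,_]′)
open import Data.Empty using (⊥-elim)
open import Data.Maybe using (just; nothing)
open import Function using (_∘_; id; flip)
open import Function.Bundles using (_⇔_; Equivalence; mk⇔)
open import Relation.Binary.PropositionalEquality using (_≡_; refl; sym; trans; cong; cong₂; subst; subst₂; module ≡-Reasoning)
open import Relation.Nullary using (¬_; yes; no)
open import Relation.Nullary.Decidable using (T?)

private
  variable
    m k : ℕ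

-- Vectors over GF(2) and their spans

infixr 6 _⊕_

_⊕_ : Vec Bool m → Vec Bool m → Vec Bool m
_⊕_ = zipWith _xor_

𝟎 : Vec Bool m
𝟎 = replicate _ false

⊕-assoc : (a b c : Vec Bool m) → (a ⊕ b) ⊕ c ≡ a ⊕ (b ⊕ c)
⊕-assoc = zipWith-assoc xor-assoc

⊕-comm : (a b : Vec Bool m) → a ⊕ b ≡ b ⊕ a
⊕-comm = zipWith-comm xor-comm

⊕-identityˡ : (a : Vec Bool m) → 𝟎 ⊕ a ≡ a
⊕-identityˡ = zipWith-identityˡ xor-identityˡ

⊕-identityʳ : (a : Vec Bool m) → a ⊕ 𝟎 ≡ a
⊕-identityʳ = zipWith-identityʳ xor-identityʳ

⊕-self : (a : Vec Bool m) → a ⊕ a ≡ 𝟎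
⊕-self []      = refl
⊕-self (x ∷ a) = cong₂ _∷_ (xor-same x) (⊕-self a)

⊕-cancelˡ : (a b : Vec Bool m) → a ⊕ (a ⊕ b) ≡ b
⊕-cancelˡ a b = begin
  a ⊕ (a ⊕ b)  ≡⟨ ⊕-assoc a a b ⟨
  (a ⊕ a) ⊕ b  ≡⟨ cong (_⊕ b) (⊕-self a) ⟩
  𝟎 ⊕ b        ≡⟨ ⊕-identityˡ b ⟩
  b            ∎
  where open ≡-Reasoning

⊕-exchange : (a b c : Vec Bool m) → a ⊕ (b ⊕ c) ≡ b ⊕ (a ⊕ c)
⊕-exchange a b c = begin
  a ⊕ (b ⊕ c)  ≡⟨ ⊕-assoc a b c ⟨
  (a ⊕ b) ⊕ c  ≡⟨ cong (_⊕ c) (⊕-comm a b) ⟩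
  (b ⊕ a) ⊕ c  ≡⟨ ⊕-assoc b a c ⟩
  b ⊕ (a ⊕ c)  ∎
  where open ≡-Reasoning

⊕-cancel-common : (c a b : Vec Bool m) → (c ⊕ a) ⊕ (c ⊕ b) ≡ a ⊕ b
⊕-cancel-common c a b = begin
  (c ⊕ a) ⊕ (c ⊕ b)  ≡⟨ ⊕-assoc c a (c ⊕ b) ⟩
  c ⊕ (a ⊕ (c ⊕ b))  ≡⟨ cong (c ⊕_) (⊕-exchange a c b) ⟩
  c ⊕ (c ⊕ (a ⊕ b))  ≡⟨ ⊕-cancelˡ c (a ⊕ b) ⟩
  a ⊕ b              ∎
  where open ≡-Reasoning

data Span {m} : List (Vec Bool m) → Vec Bool m → Set where
  ∅    : Span [] 𝟎
  skip : ∀ {r rs v} → Span rs v → Span (r ∷ rs) v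
  keep : ∀ {r rs v} → Span rs v → Span (r ∷ rs) (r ⊕ v)

span-𝟎 : (rs : List (Vec Bool m)) → Span rs 𝟎
span-𝟎 []       = ∅
span-𝟎 (r ∷ rs) = skip (span-𝟎 rs)

span-⊕ : ∀ {rs : List (Vec Bool m)} {a b} → Span rs a → Span rs b → Span rs (a ⊕ b)
span-⊕ ∅ q = subst (Span []) (sym (⊕-identityˡ _)) q
span-⊕ (skip p) (skip q) = skip (span-⊕ p q)
span-⊕ {a = a} (skip p) (keep {r} {v = b} q) =
  subst (Span _) (sym (⊕-exchange a r b)) (keep (span-⊕ p q))
span-⊕ (keep {r} {v = a} p) (skip {v = b} q) =
  subst (Span _) (sym (⊕-assoc r a b)) (keep (span-⊕ p q))
span-⊕ (keep {r} {v = a} p) (keep {v = b} q) =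
  subst (Span _) (sym (⊕-cancel-common r a b)) (skip (span-⊕ p q))

span-∈ : ∀ {rs : List (Vec Bool m)} {r} → r ∈ₗ rs → Span rs r
span-∈ {rs = r ∷ rs} (here refl) = subst (Span _) (⊕-identityʳ r) (keep (span-𝟎 rs))
span-∈ (there p) = skip (span-∈ p)

infix 4 _⊑_

_⊑_ : List (Vec Bool m) → List (Vec Bool m) → Set
rs ⊑ qs = ∀ {v} → Span rs v → Span qs v

⊑-generated : ∀ {rs qs : List (Vec Bool m)} → (∀ {r} → r ∈ₗ rs → Span qs r) → rs ⊑ qs
⊑-generated {qs = qs} h ∅ = span-𝟎 qs
⊑-generated h (skip p) = ⊑-generated (h ∘ there) p
⊑-generated h (keep p) = span-⊕ (h (here refl)) (⊑-generated (h ∘ there) p)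

⊆⇒⊑ : ∀ {rs qs : List (Vec Bool m)} → rs ⊆ₗ qs → rs ⊑ qs
⊆⇒⊑ h = ⊑-generated (span-∈ ∘ h)

IsLinear : (Vec Bool m → Vec Bool k) → Set
IsLinear g = (∀ a b → g (a ⊕ b) ≡ g a ⊕ g b) × g 𝟎 ≡ 𝟎

module _ {g : Vec Bool m → Vec Bool k} (g-linear : IsLinear g) where

  span-map : ∀ {rs v} → Span rs v → Span (map g rs) (g v)
  span-map ∅ = subst (Span []) (sym (proj₂ g-linear)) ∅
  span-map (skip p) = skip (span-map p)
  span-map (keep {r} {v = v} p) = subst (Span _) (sym (proj₁ g-linear r v)) (keep (span-map p))

  span-map⁻ : ∀ rs {w} → Span (map g rs) w → Σ (Vec Bool m) λ v → Span rs v × g v ≡ w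
  span-map⁻ [] ∅ = 𝟎 , ∅ , proj₂ g-linear
  span-map⁻ (r ∷ rs) (skip p) with span-map⁻ rs p
  ... | v , s , e = v , skip s , e
  span-map⁻ (r ∷ rs) (keep p) with span-map⁻ rs p
  ... | v , s , e = r ⊕ v , keep s , trans (proj₁ g-linear r v) (cong (g r ⊕_) e)

-- Rank by Gaussian elimination

HeadFalse : Vec Bool (suc m) → Set
HeadFalse r = Vec.head r ≡ false

span-headFalse : ∀ {rows : List (Vec Bool (suc m))} → All HeadFalse rows → ∀ {v} → Span rows v → HeadFalse v
span-headFalse _ ∅ = refl
span-headFalse (_ ∷ h) (skip p) = span-headFalse h p
span-headFalse {rows = (_ ∷ _) ∷ _} (refl ∷ h) (keep {v = _ ∷ _} p) = span-headFalse h p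

pickPivot-nothing : (rows : List (Vec Bool (suc m))) → pickPivot rows ≡ nothing → All HeadFalse rows
pickPivot-nothing [] _ = []
pickPivot-nothing ((false ∷ r) ∷ rs) eq with pickPivot rs in e
... | nothing = refl ∷ pickPivot-nothing rs e

pickPivot-nothing-span : (rows : List (Vec Bool (suc m))) {v : Vec Bool m} → pickPivot rows ≡ nothing → ¬ Span rows (true ∷ v)
pickPivot-nothing-span rows e s with span-headFalse (pickPivot-nothing rows e) s
... | ()

pickPivot-just : (rows : List (Vec Bool (suc m))) {p : Vec Bool m} {rs : List (Vec Bool (suc m))}
               → pickPivot rows ≡ just (p , rs) → rows ↭ (true ∷ p) ∷ rs
pickPivot-just ((true ∷ r) ∷ rs) refl = ↭-refl
pickPivot-just ((false ∷ r) ∷ rs) eq with pickPivot rs in e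
pickPivot-just ((false ∷ r) ∷ rs) refl | just _ = ↭-trans (↭-prep _ (pickPivot-just rs e)) (↭-swap _ _ ↭-refl)

pivot-∈-span : (rows : List (Vec Bool (suc m))) {p : Vec Bool m} {rs : List (Vec Bool (suc m))}
             → pickPivot rows ≡ just (p , rs) → Span rows (true ∷ p)
pivot-∈-span rows e = span-∈ (∈-resp-↭ (↭-sym (pickPivot-just rows e)) (here refl))

pickPivot-snoc-just : (rows : List (Vec Bool (suc m))) {p : Vec Bool m} {rs : List (Vec Bool (suc m))} {v : Vec Bool (suc m)}
                    → pickPivot rows ≡ just (p , rs) → pickPivot (rows ++ [ v ]) ≡ just (p , rs ++ [ v ])
pickPivot-snoc-just ((true ∷ r) ∷ rs) refl = refl
pickPivot-snoc-just ((false ∷ r) ∷ rs) {v = v} eq with pickPivot rs in e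
pickPivot-snoc-just ((false ∷ r) ∷ rs) {v = v} refl | just _
  rewrite pickPivot-snoc-just rs {v = v} e = refl

pickPivot-snoc-false : (rows : List (Vec Bool (suc m))) {v : Vec Bool m}
                     → pickPivot rows ≡ nothing → pickPivot (rows ++ [ false ∷ v ]) ≡ nothing
pickPivot-snoc-false [] refl = refl
pickPivot-snoc-false ((false ∷ r) ∷ rs) {v} eq with pickPivot rs in e
... | nothing rewrite pickPivot-snoc-false rs {v} e = refl

pickPivot-snoc-true : (rows : List (Vec Bool (suc m))) {v : Vec Bool m}
                    → pickPivot rows ≡ nothing → pickPivot (rows ++ [ true ∷ v ]) ≡ just (v , rows)
pickPivot-snoc-true [] refl = refl
pickPivot-snoc-true ((false ∷ r) ∷ rs) {v} eq with pickPivot rs in e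
... | nothing rewrite pickPivot-snoc-true rs {v} e = refl

rank-nothing : (rows : List (Vec Bool (suc m))) → pickPivot rows ≡ nothing
             → rank (suc m) rows ≡ rank m (map Vec.tail rows)
rank-nothing rows eq with pickPivot rows
rank-nothing rows refl | nothing = refl

rank-just : (rows : List (Vec Bool (suc m))) {p : Vec Bool m} {rs : List (Vec Bool (suc m))}
          → pickPivot rows ≡ just (p , rs) → rank (suc m) rows ≡ suc (rank m (map (reduce p) rs))
rank-just rows eq with pickPivot rows
rank-just rows refl | just _ = refl

tail-linear : IsLinear {suc m} Vec.tail
tail-linear = (λ { (_ ∷ _) (_ ∷ _) → refl }) , refl

reduce-linear : (p : Vec Bool m) → IsLinear (reduce p)
reduce-linear p = additive , refl
  where
  additive : ∀ a b → reduce p (a ⊕ b) ≡ reduce p a ⊕ reduce p b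
  additive (true ∷ a)  (true ∷ b)  = sym (⊕-cancel-common p a b)
  additive (true ∷ a)  (false ∷ b) = sym (⊕-assoc p a b)
  additive (false ∷ a) (true ∷ b)  = sym (⊕-exchange a p b)
  additive (false ∷ a) (false ∷ b) = refl

span-reduce⁻ : ∀ {p : Vec Bool m} {rs z} → Span (map (reduce p) rs) z → Span ((true ∷ p) ∷ rs) (false ∷ z)
span-reduce⁻ {p = p} {rs} s with span-map⁻ (reduce-linear p) rs s
... | true ∷ _  , sv , refl = keep sv
... | false ∷ _ , sv , refl = skip sv

span-reduce⁺ : ∀ {p : Vec Bool m} {rs w} → Span ((true ∷ p) ∷ rs) w → Span (map (reduce p) rs) (reduce p w)
span-reduce⁺ {p = p} (skip s) = span-map (reduce-linear p) s
span-reduce⁺ {p = p} (keep {v = true ∷ v} s) = span-map (reduce-linear p) s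
span-reduce⁺ {p = p} (keep {v = false ∷ v} s) =
  subst (Span _) (sym (⊕-cancelˡ p v)) (span-map (reduce-linear p) s)

↭⇒⊑ : ∀ {rs qs : List (Vec Bool m)} → rs ↭ qs → rs ⊑ qs
↭⇒⊑ = ⊆⇒⊑ ∘ ⊆-reflexive-↭

reduce-⊑ : ∀ {rows rows₁ : List (Vec Bool (suc m))} {p rs q qs} → rows ⊑ rows₁
         → rows ↭ (true ∷ p) ∷ rs → rows₁ ↭ (true ∷ q) ∷ qs → map (reduce p) rs ⊑ map (reduce q) qs
reduce-⊑ h π π₁ = span-reduce⁺ ∘ ↭⇒⊑ π₁ ∘ h ∘ ↭⇒⊑ (↭-sym π) ∘ span-reduce⁻

tail-⊑ : ∀ {rows rows₁ : List (Vec Bool (suc m))} → rows ⊑ rows₁ → map Vec.tail rows ⊑ map Vec.tail rows₁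
tail-⊑ {rows = rows} h s with span-map⁻ tail-linear rows s
... | _ , s₁ , refl = span-map tail-linear (h s₁)

rank-cong : ∀ m {rows rows₁ : List (Vec Bool m)} → rows ⊑ rows₁ → rows₁ ⊑ rows → rank m rows ≡ rank m rows₁
rank-cong zero _ _ = refl
rank-cong (suc m) {rows} {rows₁} s s₁ with pickPivot rows in e | pickPivot rows₁ in e₁
... | nothing | nothing = rank-cong m (tail-⊑ s) (tail-⊑ s₁)
... | nothing | just _  = ⊥-elim (pickPivot-nothing-span rows e (s₁ (pivot-∈-span rows₁ e₁)))
... | just _  | nothing = ⊥-elim (pickPivot-nothing-span rows₁ e₁ (s (pivot-∈-span rows e)))
... | just _  | just _  =
  cong suc (rank-cong m (reduce-⊑ s (pickPivot-just rows e) (pickPivot-just rows₁ e₁))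
                        (reduce-⊑ s₁ (pickPivot-just rows₁ e₁) (pickPivot-just rows e)))

rank-resp-↭ : ∀ m {rows rows₁ : List (Vec Bool m)} → rows ↭ rows₁ → rank m rows ≡ rank m rows₁
rank-resp-↭ m π = rank-cong m (↭⇒⊑ π) (↭⇒⊑ (↭-sym π))

span-unreduce : ∀ {p : Vec Bool m} {rs} (v : Vec Bool (suc m))
              → Span ((true ∷ p) ∷ rs) (false ∷ reduce p v) → Span ((true ∷ p) ∷ rs) v
span-unreduce {p = p} (true ∷ v) s =
  subst (Span _) (cong (true ∷_) (⊕-cancelˡ p v)) (span-⊕ (span-∈ (here refl)) s)
span-unreduce (false ∷ v) s = s

all-headFalse-tail : ∀ {rows : List (Vec Bool (suc m))} → All HeadFalse rows → map (false ∷_) (map Vec.tail rows) ≡ rows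
all-headFalse-tail [] = refl
all-headFalse-tail {rows = (false ∷ _) ∷ _} (refl ∷ h) = cong (_ ∷_) (all-headFalse-tail h)

all-headFalse-reduce : ∀ {p : Vec Bool m} {rows} → All HeadFalse rows → map (reduce p) rows ≡ map Vec.tail rows
all-headFalse-reduce [] = refl
all-headFalse-reduce {rows = (false ∷ _) ∷ _} (refl ∷ h) = cong (_ ∷_) (all-headFalse-reduce h)

rank-snoc : ∀ m (rows : List (Vec Bool m)) v
          → (rank m (rows ++ [ v ]) ≡ rank m rows × Span rows v) ⊎ rank m (rows ++ [ v ]) ≡ suc (rank m rows)
rank-snoc zero rows [] = inj₁ (refl , span-𝟎 rows)
rank-snoc (suc m) rows v with pickPivot rows in e
... | just (p , rs) =
  Sum.map (λ (eq , s) → trans unfold (cong suc eq)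
                       , ↭⇒⊑ (↭-sym (pickPivot-just rows e)) (span-unreduce v (span-reduce⁻ s)))
          (trans unfold ∘ cong suc)
          (rank-snoc m (map (reduce p) rs) (reduce p v))
  where
  unfold : rank (suc m) (rows ++ [ v ]) ≡ suc (rank m (map (reduce p) rs ++ [ reduce p v ]))
  unfold = trans (rank-just (rows ++ [ v ]) (pickPivot-snoc-just rows e))
                 (cong (suc ∘ rank m) (map-++ (reduce p) rs [ v ]))
rank-snoc (suc m) rows (true ∷ v) | nothing =
  inj₂ (trans (rank-just (rows ++ [ true ∷ v ]) (pickPivot-snoc-true rows e))
              (cong (suc ∘ rank m) (all-headFalse-reduce (pickPivot-nothing rows e))))
rank-snoc (suc m) rows (false ∷ v) | nothing =
  Sum.map (λ (eq , s) → trans unfold eq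
                       , subst (λ z → Span z (false ∷ v)) (all-headFalse-tail (pickPivot-nothing rows e))
                               (span-map ((λ _ _ → refl) , refl) s))
          (trans unfold)
          (rank-snoc m (map Vec.tail rows) v)
  where
  unfold : rank (suc m) (rows ++ [ false ∷ v ]) ≡ rank m (map Vec.tail rows ++ [ v ])
  unfold = trans (rank-nothing _ (pickPivot-snoc-false rows e)) (cong (rank m) (map-++ Vec.tail rows [ false ∷ v ]))

rank-[] : ∀ m → rank m [] ≡ 0
rank-[] zero    = refl
rank-[] (suc m) = rank-[] m

rank-snoc-≤ : ∀ m (rows : List (Vec Bool m)) v → rank m (rows ++ [ v ]) ≤ suc (rank m rows)
rank-snoc-≤ m rows v with rank-snoc m rows v
... | inj₁ (eq , _) = ≤-trans (≤-reflexive eq) (n≤1+n _)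
... | inj₂ eq       = ≤-reflexive eq

span⇒rank-snoc≡ : ∀ m {rows : List (Vec Bool m)} {v} → Span rows v → rank m (rows ++ [ v ]) ≡ rank m rows
span⇒rank-snoc≡ m {rows} v∈ = rank-cong m (⊑-generated spanned) (⊆⇒⊑ (xs⊆xs++ys rows [ _ ]))
  where
  spanned : ∀ {r} → r ∈ₗ rows ++ [ _ ] → Span rows r
  spanned r∈ with ∈-++⁻ rows r∈
  ... | inj₁ r∈rows    = span-∈ r∈rows
  ... | inj₂ (here refl) = v∈

rank-snoc≡⇒span : ∀ m {rows : List (Vec Bool m)} {v} → rank m (rows ++ [ v ]) ≡ rank m rows → Span rows v
rank-snoc≡⇒span m {rows} {v} eq with rank-snoc m rows v
... | inj₁ (_ , v∈) = v∈
... | inj₂ eq₁      = ⊥-elim (1+n≢n (trans (sym eq₁) eq))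

rank-snoc-mono : ∀ m (rows : List (Vec Bool m)) v → rank m rows ≤ rank m (rows ++ [ v ])
rank-snoc-mono m rows v with rank-snoc m rows v
... | inj₁ (eq , _) = ≤-reflexive (sym eq)
... | inj₂ eq       = ≤-trans (n≤1+n _) (≤-reflexive (sym eq))

rank-++-mono : ∀ m (rows qs : List (Vec Bool m)) → rank m rows ≤ rank m (rows ++ qs)
rank-++-mono m rows [] = ≤-reflexive (cong (rank m) (sym (++-identityʳ rows)))
rank-++-mono m rows (q ∷ qs) = begin
  rank m rows                    ≤⟨ rank-snoc-mono m rows q ⟩
  rank m (rows ++ [ q ])         ≤⟨ rank-++-mono m (rows ++ [ q ]) qs ⟩
  rank m ((rows ++ [ q ]) ++ qs) ≡⟨ cong (rank m) (++-assoc rows [ q ] qs) ⟩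
  rank m (rows ++ q ∷ qs)        ∎
  where open ≤-Reasoning

rank-≤-length : ∀ m (qs : List (Vec Bool m)) → rank m qs ≤ length qs
rank-≤-length m [] = ≤-reflexive (rank-[] m)
rank-≤-length m (q ∷ qs) = begin
  rank m (q ∷ qs)      ≡⟨ rank-resp-↭ m (∷↭∷ʳ q qs) ⟩
  rank m (qs ++ [ q ]) ≤⟨ rank-snoc-≤ m qs q ⟩
  suc (rank m qs)      ≤⟨ s≤s (rank-≤-length m qs) ⟩
  suc (length qs)      ∎
  where open ≤-Reasoning

rank-≤-spanning : ∀ m {rows qs : List (Vec Bool m)} → rows ⊑ qs → rank m rows ≤ length qs
rank-≤-spanning m {rows} {qs} rows⊑qs = begin
  rank m rows         ≤⟨ rank-++-mono m rows qs ⟩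
  rank m (rows ++ qs) ≡⟨ rank-cong m (⊑-generated spanned) (⊆⇒⊑ (xs⊆ys++xs qs rows)) ⟩
  rank m qs           ≤⟨ rank-≤-length m qs ⟩
  length qs           ∎
  where
  open ≤-Reasoning
  spanned : ∀ {r} → r ∈ₗ rows ++ qs → Span qs r
  spanned r∈ with ∈-++⁻ rows r∈
  ... | inj₁ r∈rows = rows⊑qs (span-∈ r∈rows)
  ... | inj₂ r∈qs   = span-∈ r∈qs

spanning-of-length-rank : ∀ m (rows : List (Vec Bool m)) → Σ (List (Vec Bool m)) λ qs → length qs ≡ rank m rows × rows ⊑ qs
spanning-of-length-rank m [] = [] , sym (rank-[] m) , id
spanning-of-length-rank m (r ∷ rs) with spanning-of-length-rank m rs | rank-snoc m rs r
... | qs , len , rs⊑qs | inj₁ (eq , r∈) =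
  qs , trans len (sym (trans (rank-resp-↭ m (∷↭∷ʳ r rs)) eq)) , ⊑-generated spanned
  where
  spanned : ∀ {x} → x ∈ₗ r ∷ rs → Span qs x
  spanned (here refl) = rs⊑qs r∈
  spanned (there x∈)  = rs⊑qs (span-∈ x∈)
... | qs , len , rs⊑qs | inj₂ eq =
  r ∷ qs , trans (cong suc len) (sym (trans (rank-resp-↭ m (∷↭∷ʳ r rs)) eq)) , ⊑-generated spanned
  where
  spanned : ∀ {x} → x ∈ₗ r ∷ rs → Span (r ∷ qs) x
  spanned (here refl) = span-∈ (here refl)
  spanned (there x∈)  = skip (rs⊑qs (span-∈ x∈))

-- Rank of submatrices

dot : Vec Bool k → Vec Bool k → Bool
dot []      _ = false
dot (a ∷ u) v = (a ∧ Vec.head v) xor dot u (Vec.tail v)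

dot-comm : (u v : Vec Bool k) → dot u v ≡ dot v u
dot-comm []      []      = refl
dot-comm (a ∷ u) (b ∷ v) = cong₂ _xor_ (∧-comm a b) (dot-comm u v)

combination : (qs : List (Vec Bool m)) → Vec Bool (length qs) → Vec Bool m
combination []       _             = 𝟎
combination (q ∷ qs) (true ∷ c)  = q ⊕ combination qs c
combination (q ∷ qs) (false ∷ c) = combination qs c

span⇒combination : ∀ {qs : List (Vec Bool m)} {v} → Span qs v → Σ (Vec Bool (length qs)) λ c → combination qs c ≡ v
span⇒combination ∅ = [] , refl
span⇒combination (skip s) with span⇒combination s
... | c , e = false ∷ c , e
span⇒combination {qs = q ∷ _} (keep s) with span⇒combination s
... | c , e = true ∷ c , cong (q ⊕_) e

column : (qs : List (Vec Bool m)) → Fin m → Vec Bool (length qs)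
column []       _ = []
column (q ∷ qs) l = Vec.lookup q l ∷ column qs l

lookup-⊕ : (a b : Vec Bool m) (l : Fin m) → Vec.lookup (a ⊕ b) l ≡ Vec.lookup a l xor Vec.lookup b l
lookup-⊕ a b l = lookup-zipWith _xor_ l a b

lookup-combination : (qs : List (Vec Bool m)) (c : Vec Bool (length qs)) (l : Fin m)
                   → Vec.lookup (combination qs c) l ≡ dot c (column qs l)
lookup-combination []       []          l = lookup-replicate l false
lookup-combination (q ∷ qs) (true ∷ c)  l =
  trans (lookup-⊕ q (combination qs c) l) (cong (Vec.lookup q l xor_) (lookup-combination qs c l))
lookup-combination (q ∷ qs) (false ∷ c) l = lookup-combination qs c l

module _ {B : Set} where

  tabulate∈ : {X : Set} (C : List B) → (∀ {j} → j ∈ₗ C → X) → Vec X (length C)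
  tabulate∈ []      g = []
  tabulate∈ (c ∷ C) g = g (here refl) ∷ tabulate∈ C (g ∘ there)

  tabulate∈-cong : ∀ {X : Set} (C : List B) {g h : ∀ {j} → j ∈ₗ C → X} → (∀ {j} (p : j ∈ₗ C) → g p ≡ h p)
                 → tabulate∈ C g ≡ tabulate∈ C h
  tabulate∈-cong []      e = refl
  tabulate∈-cong (c ∷ C) e = cong₂ _∷_ (e (here refl)) (tabulate∈-cong C (e ∘ there))

  tabulate∈-const : ∀ {X : Set} (C : List B) (g : B → X) → Vec.map g (Vec.fromList C) ≡ tabulate∈ C (λ {j} _ → g j)
  tabulate∈-const []      g = refl
  tabulate∈-const (c ∷ C) g = cong (g c ∷_) (tabulate∈-const C g)

  tabulate∈-𝟎 : (C : List B) → tabulate∈ C (λ _ → false) ≡ 𝟎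
  tabulate∈-𝟎 []      = refl
  tabulate∈-𝟎 (c ∷ C) = cong (false ∷_) (tabulate∈-𝟎 C)

  tabulate∈-⊕ : (C : List B) (g h : ∀ {j} → j ∈ₗ C → Bool)
              → tabulate∈ C (λ p → g p xor h p) ≡ tabulate∈ C g ⊕ tabulate∈ C h
  tabulate∈-⊕ []      g h = refl
  tabulate∈-⊕ (c ∷ C) g h = cong (_ ∷_) (tabulate∈-⊕ C (g ∘ there) (h ∘ there))

  lookup-fromList-index : ∀ {X : Set} (g : B → X) {C : List B} {j} (p : j ∈ₗ C)
                        → Vec.lookup (Vec.map g (Vec.fromList C)) (Any.index p) ≡ g j
  lookup-fromList-index g (here refl) = refl
  lookup-fromList-index g (there p)   = lookup-fromList-index g p

module _ {A B : Set} (f : A → B → Bool) where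

  row : (C : List B) → A → Vec Bool (length C)
  row C i = Vec.map (f i) (Vec.fromList C)

  rk : List A → List B → ℕ
  rk R C = rank (length C) (map (row C) R)

  -- U and W are indexed by membership proofs, so that no decidable equality on A or B is needed.
  Factorisation : List A → List B → ℕ → Set
  Factorisation R C k =
    Σ (∀ {i} → i ∈ₗ R → Vec Bool k) λ U → Σ (∀ {j} → j ∈ₗ C → Vec Bool k) λ W →
      ∀ {i j} (i∈R : i ∈ₗ R) (j∈C : j ∈ₗ C) → f i j ≡ dot (U i∈R) (W j∈C)

  Factorisation⇒rk≤ : ∀ {R C k} → Factorisation R C k → rk R C ≤ k
  Factorisation⇒rk≤ {R} {C} {k} (U , W , f≡UW) =
    ≤-trans (rank-≤-spanning (length C) (⊑-generated spanned)) (≤-reflexive (length-coordinates k (λ {j} → W {j})))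
    where
    coordinates : ∀ k → (∀ {j} → j ∈ₗ C → Vec Bool k) → List (Vec Bool (length C))
    coordinates zero    W = []
    coordinates (suc k) W = tabulate∈ C (λ p → Vec.head (W p)) ∷ coordinates k (λ p → Vec.tail (W p))

    length-coordinates : ∀ k (W : ∀ {j} → j ∈ₗ C → Vec Bool k) → length (coordinates k W) ≡ k
    length-coordinates zero    W = refl
    length-coordinates (suc k) W = cong suc (length-coordinates k (λ p → Vec.tail (W p)))

    span-coordinates : ∀ k (u : Vec Bool k) (W : ∀ {j} → j ∈ₗ C → Vec Bool k)
                     → Span (coordinates k W) (tabulate∈ C (λ p → dot u (W p)))
    span-coordinates zero    [] W = subst (Span []) (sym (tabulate∈-𝟎 C)) ∅
    span-coordinates (suc k) (true ∷ u) W =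
      subst (Span _) (sym (tabulate∈-⊕ C (λ p → Vec.head (W p)) (λ p → dot u (Vec.tail (W p)))))
            (keep (span-coordinates k u (λ p → Vec.tail (W p))))
    span-coordinates (suc k) (false ∷ u) W = skip (span-coordinates k u (λ p → Vec.tail (W p)))

    spanned : ∀ {r} → r ∈ₗ map (row C) R → Span (coordinates k W) r
    spanned r∈ with ∈-map⁻ (row C) r∈
    ... | i , i∈R , refl =
      subst (Span _) (sym (trans (tabulate∈-const C (f i)) (tabulate∈-cong C (f≡UW i∈R))))
            (span-coordinates k (U i∈R) (λ {j} → W {j}))

  rk-Factorisation : ∀ R C → Factorisation R C (rk R C)
  rk-Factorisation R C with spanning-of-length-rank (length C) (map (row C) R)
  ... | qs , len , rows⊑qs = subst (Factorisation R C) len (U , W , f≡UW)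
    where
    coefficients : ∀ {i} → i ∈ₗ R → Σ (Vec Bool (length qs)) λ c → combination qs c ≡ row C i
    coefficients i∈R = span⇒combination (rows⊑qs (span-∈ (∈-map⁺ (row C) i∈R)))
    U : ∀ {i} → i ∈ₗ R → Vec Bool (length qs)
    U = proj₁ ∘ coefficients
    W : ∀ {j} → j ∈ₗ C → Vec Bool (length qs)
    W j∈C = column qs (Any.index j∈C)
    f≡UW : ∀ {i j} (i∈R : i ∈ₗ R) (j∈C : j ∈ₗ C) → f i j ≡ dot (U i∈R) (W j∈C)
    f≡UW {i} i∈R j∈C = begin
      f i _                                     ≡⟨ lookup-fromList-index (f i) j∈C ⟨
      Vec.lookup (row C i) l                    ≡⟨ cong (λ v → Vec.lookup v l) (proj₂ (coefficients i∈R)) ⟨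
      Vec.lookup (combination qs (U i∈R)) l     ≡⟨ lookup-combination qs (U i∈R) l ⟩
      dot (U i∈R) (W j∈C)                       ∎
      where
      open ≡-Reasoning
      l = Any.index j∈C

  rk-mono : ∀ {R R₁ C C₁} → R₁ ⊆ₗ R → C₁ ⊆ₗ C → rk R₁ C₁ ≤ rk R C
  rk-mono R₁⊆R C₁⊆C with rk-Factorisation _ _
  ... | U , W , f≡UW =
    Factorisation⇒rk≤ (U ∘ R₁⊆R , W ∘ C₁⊆C , λ i∈ j∈ → f≡UW (R₁⊆R i∈) (C₁⊆C j∈))

  rk-cong : ∀ {R R₁ C C₁} → R ⊆ₗ R₁ → R₁ ⊆ₗ R → C ⊆ₗ C₁ → C₁ ⊆ₗ C → rk R C ≡ rk R₁ C₁
  rk-cong R⊆R₁ R₁⊆R C⊆C₁ C₁⊆C = ≤-antisym (rk-mono R⊆R₁ C⊆C₁) (rk-mono R₁⊆R C₁⊆C)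

  RowSpan : List A → List B → A → Set
  RowSpan R C r = Span (map (row C) R) (row C r)

  RowSpan-restrict : ∀ {R R₁ C C₁ r} → R ⊆ₗ R₁ → C₁ ⊆ₗ C → RowSpan R C r → RowSpan R₁ C₁ r
  RowSpan-restrict {R} {R₁} {C} {C₁} {r} R⊆R₁ C₁⊆C s =
    ⊆⇒⊑ (map⁺ (row C₁) R⊆R₁) (subst₂ Span map-project (project-row r) (span-map project-linear s))
    where
    project : Vec Bool (length C) → Vec Bool (length C₁)
    project v = tabulate∈ C₁ (λ p → Vec.lookup v (Any.index (C₁⊆C p)))
    project-linear : IsLinear project
    project-linear =
      (λ a b → trans (tabulate∈-cong C₁ (λ p → lookup-⊕ a b _)) (tabulate∈-⊕ C₁ _ _)) ,
      trans (tabulate∈-cong C₁ (λ p → lookup-replicate (Any.index (C₁⊆C p)) false)) (tabulate∈-𝟎 C₁)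
    project-row : ∀ i → project (row C i) ≡ row C₁ i
    project-row i =
      trans (tabulate∈-cong C₁ (λ p → lookup-fromList-index (f i) (C₁⊆C p))) (sym (tabulate∈-const C₁ (f i)))
    map-project : map project (map (row C) R) ≡ map (row C₁) R
    map-project = trans (sym (map-∘ R)) (map-cong project-row R)

  rk-snoc : ∀ R C r → (rk (R ++ [ r ]) C ≡ rk R C × RowSpan R C r) ⊎ rk (R ++ [ r ]) C ≡ suc (rk R C)
  rk-snoc R C r rewrite map-++ (row C) R [ r ] = rank-snoc (length C) (map (row C) R) (row C r)

  rk-snoc-≤ : ∀ R C r → rk (R ++ [ r ]) C ≤ suc (rk R C)
  rk-snoc-≤ R C r rewrite map-++ (row C) R [ r ] = rank-snoc-≤ (length C) (map (row C) R) (row C r)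

  RowSpan⇒rk-snoc≡ : ∀ {R C r} → RowSpan R C r → rk (R ++ [ r ]) C ≡ rk R C
  RowSpan⇒rk-snoc≡ {R} {C} {r} rewrite map-++ (row C) R [ r ] = span⇒rank-snoc≡ (length C)

  rk-snoc≡⇒RowSpan : ∀ {R C r} → rk (R ++ [ r ]) C ≡ rk R C → RowSpan R C r
  rk-snoc≡⇒RowSpan {R} {C} {r} rewrite map-++ (row C) R [ r ] = rank-snoc≡⇒span (length C)

Factorisation-transpose : ∀ {A B : Set} (f : A → B → Bool) {R C k} → Factorisation f R C k → Factorisation (flip f) C R k
Factorisation-transpose f (U , W , f≡UW) = W , U , λ j∈C i∈R → trans (f≡UW i∈R j∈C) (dot-comm (U i∈R) (W j∈C))

rk-transpose : ∀ {A B : Set} (f : A → B → Bool) R C → rk f R C ≡ rk (flip f) C R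
rk-transpose f R C = ≤-antisym
  (Factorisation⇒rk≤ f (Factorisation-transpose (flip f) (rk-Factorisation (flip f) C R)))
  (Factorisation⇒rk≤ (flip f) (Factorisation-transpose f (rk-Factorisation f R C)))

rk-cong-pointwise : ∀ {A B : Set} {f g : A → B → Bool} → (∀ i j → f i j ≡ g i j) → ∀ R C → rk f R C ≡ rk g R C
rk-cong-pointwise f≡g R C = cong (rank (length C)) (map-cong (λ i → Vec-map-cong (f≡g i) (Vec.fromList C)) R)

-- Cut-rank

module _ {n : ℕ} where

  ∈-inside⁺ : ∀ {X : Subset n} {j} → j ∈ X → j ∈ₗ inside X
  ∈-inside⁺ {X} {j} j∈X =
    ∈-filter⁺ (T? ∘ Vec.lookup X) (∈-allFin j) (Equivalence.from T-≡ ([]=⇒lookup j∈X))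

  ∈-inside⁻ : ∀ (X : Subset n) {j} → j ∈ₗ inside X → j ∈ X
  ∈-inside⁻ X {j} j∈ =
    lookup⇒[]= j X (Equivalence.to T-≡ (proj₂ (∈-filter⁻ (T? ∘ Vec.lookup X) {xs = List.allFin n} j∈)))

  ∈-outside⁺ : ∀ {X : Subset n} {j} → j ∉ X → j ∈ₗ outside X
  ∈-outside⁺ {X} {j} j∉X =
    ∈-filter⁺ (T? ∘ not ∘ Vec.lookup X) (∈-allFin j) (Equivalence.from T-not-≡ (¬-not (j∉X ∘ lookup⇒[]= j X)))

  ∈-outside⁻ : ∀ (X : Subset n) {j} → j ∈ₗ outside X → j ∉ X
  ∈-outside⁻ X {j} j∈ =
    not-¬ (Equivalence.to T-not-≡ (proj₂ (∈-filter⁻ (T? ∘ not ∘ Vec.lookup X) {xs = List.allFin n} j∈))) ∘ []=⇒lookup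

  inside-mono : ∀ {X Y : Subset n} → X ⊆ Y → inside X ⊆ₗ inside Y
  inside-mono {X} X⊆Y = ∈-inside⁺ ∘ X⊆Y ∘ ∈-inside⁻ X

  outside-anti : ∀ {X Y : Subset n} → X ⊆ Y → outside Y ⊆ₗ outside X
  outside-anti {Y = Y} X⊆Y j∈ = ∈-outside⁺ (∈-outside⁻ Y j∈ ∘ X⊆Y)

  ∈-∪⁅⁆⁻ : ∀ (X : Subset n) t {x} → x ∈ X ∪ ⁅ t ⁆ → x ∈ X ⊎ x ≡ t
  ∈-∪⁅⁆⁻ X t x∈ = Sum.map₂ (x∈⁅y⁆⇒x≡y t) (x∈p∪q⁻ X ⁅ t ⁆ x∈)

  t∈X∪⁅t⁆ : ∀ (X : Subset n) t → t ∈ X ∪ ⁅ t ⁆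
  t∈X∪⁅t⁆ X t = x∈p∪q⁺ (inj₂ (x∈⁅x⁆ t))

  inside-∪⁅⁆ : ∀ (X : Subset n) t → inside (X ∪ ⁅ t ⁆) ⊆ₗ inside X ++ [ t ]
  inside-∪⁅⁆ X t j∈ with ∈-∪⁅⁆⁻ X t (∈-inside⁻ (X ∪ ⁅ t ⁆) j∈)
  ... | inj₁ j∈X  = ∈-++⁺ˡ (∈-inside⁺ j∈X)
  ... | inj₂ refl = ∈-++⁺ʳ (inside X) (here refl)

  inside-∪⁅⁆⁻ : ∀ (X : Subset n) t → inside X ++ [ t ] ⊆ₗ inside (X ∪ ⁅ t ⁆)
  inside-∪⁅⁆⁻ X t j∈ with ∈-++⁻ (inside X) j∈
  ... | inj₁ j∈X        = ∈-inside⁺ (x∈p∪q⁺ (inj₁ (∈-inside⁻ X j∈X)))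
  ... | inj₂ (here refl) = ∈-inside⁺ (t∈X∪⁅t⁆ X t)

  outside-∪⁅⁆ : ∀ (X : Subset n) t → outside X ⊆ₗ outside (X ∪ ⁅ t ⁆) ++ [ t ]
  outside-∪⁅⁆ X t {j} j∈ with j ≟ t
  ... | yes refl = ∈-++⁺ʳ _ (here refl)
  ... | no j≢t   = ∈-++⁺ˡ (∈-outside⁺ ([ ∈-outside⁻ X j∈ , j≢t ]′ ∘ ∈-∪⁅⁆⁻ X t))

  outside-∪⁅⁆⁻ : ∀ {X : Subset n} {t} → t ∉ X → outside (X ∪ ⁅ t ⁆) ++ [ t ] ⊆ₗ outside X
  outside-∪⁅⁆⁻ {X} {t} t∉X j∈ with ∈-++⁻ (outside (X ∪ ⁅ t ⁆)) j∈
  ... | inj₁ j∈₁         = ∈-outside⁺ (∈-outside⁻ (X ∪ ⁅ t ⁆) j∈₁ ∘ x∈p∪q⁺ ∘ inj₁)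
  ... | inj₂ (here refl) = ∈-outside⁺ t∉X

module _ {n : ℕ} (G : Graph n) where

  rk-symmetric : ∀ R C → rk (adj G) R C ≡ rk (adj G) C R
  rk-symmetric R C = trans (rk-transpose (adj G) R C) (rk-cong-pointwise (λ i j → symmetric G j i) C R)

  cutRank-∪⁅⁆ : ∀ X t → cutRank G (X ∪ ⁅ t ⁆) ≡ rk (adj G) (inside X ++ [ t ]) (outside (X ∪ ⁅ t ⁆))
  cutRank-∪⁅⁆ X t = rk-cong (adj G) {C = outside (X ∪ ⁅ t ⁆)} (inside-∪⁅⁆ X t) (inside-∪⁅⁆⁻ X t) id id

  cutRank-transposed : ∀ {X t} → t ∉ X → cutRank G X ≡ rk (adj G) (outside (X ∪ ⁅ t ⁆) ++ [ t ]) (inside X)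
  cutRank-transposed {X} {t} t∉X =
    trans (rk-cong (adj G) {R = inside X} id id (outside-∪⁅⁆ X t) (outside-∪⁅⁆⁻ t∉X)) (rk-symmetric (inside X) _)

  module _ {A Y : Subset n} {t} (t∉A : t ∉ A) (Y⊆A : Y ⊆ A) where

    private
      IA = inside A
      IY = inside Y
      OA = outside (A ∪ ⁅ t ⁆)
      OY = outside (Y ∪ ⁅ t ⁆)

      t∉Y : t ∉ Y
      t∉Y = t∉A ∘ Y⊆A

      IY⊆IA : IY ⊆ₗ IA
      IY⊆IA = inside-mono Y⊆A

      OA⊆OY : OA ⊆ₗ OY
      OA⊆OY = outside-anti ([ x∈p∪q⁺ ∘ inj₁ ∘ Y⊆A , (λ { refl → t∈X∪⁅t⁆ A t }) ]′ ∘ ∈-∪⁅⁆⁻ Y t)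

    row-spanned⇒column-spanned : cutRank G (A ∪ ⁅ t ⁆) ≡ cutRank G A
                               → RowSpan (adj G) IY OY t → RowSpan (adj G) OY IY t
    row-spanned⇒column-spanned ρ-eq t-spanned = RowSpan-restrict (adj G) OA⊆OY IY⊆IA (rk-snoc≡⇒RowSpan (adj G) (begin
      rk (adj G) (OA ++ [ t ]) IA ≡⟨ cutRank-transposed t∉A ⟨
      cutRank G A                 ≡⟨ ρ-eq ⟨
      cutRank G (A ∪ ⁅ t ⁆)       ≡⟨ cutRank-∪⁅⁆ A t ⟩
      rk (adj G) (IA ++ [ t ]) OA ≡⟨ RowSpan⇒rk-snoc≡ (adj G) (RowSpan-restrict (adj G) IY⊆IA OA⊆OY t-spanned) ⟩
      rk (adj G) IA OA            ≡⟨ rk-symmetric IA OA ⟩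
      rk (adj G) OA IA            ∎))
      where open ≡-Reasoning

    cutRank-∪⁅⁆-mono : cutRank G (A ∪ ⁅ t ⁆) ≡ cutRank G A → cutRank G Y ≤ cutRank G (Y ∪ ⁅ t ⁆)
    cutRank-∪⁅⁆-mono ρ-eq with rk-snoc (adj G) IY OY t
    ... | inj₁ (same , t-spanned) = begin
      cutRank G Y                 ≡⟨ cutRank-transposed t∉Y ⟩
      rk (adj G) (OY ++ [ t ]) IY ≡⟨ RowSpan⇒rk-snoc≡ (adj G) (row-spanned⇒column-spanned ρ-eq t-spanned) ⟩
      rk (adj G) OY IY            ≡⟨ rk-symmetric OY IY ⟩
      rk (adj G) IY OY            ≡⟨ same ⟨
      rk (adj G) (IY ++ [ t ]) OY ≡⟨ cutRank-∪⁅⁆ Y t ⟨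
      cutRank G (Y ∪ ⁅ t ⁆)       ∎
      where open ≤-Reasoning
    ... | inj₂ grows = begin
      cutRank G Y                 ≡⟨ cutRank-transposed t∉Y ⟩
      rk (adj G) (OY ++ [ t ]) IY ≤⟨ rk-snoc-≤ (adj G) OY IY t ⟩
      suc (rk (adj G) OY IY)      ≡⟨ cong suc (rk-symmetric OY IY) ⟩
      suc (rk (adj G) IY OY)      ≡⟨ grows ⟨
      rk (adj G) (IY ++ [ t ]) OY ≡⟨ cutRank-∪⁅⁆ Y t ⟨
      cutRank G (Y ∪ ⁅ t ⁆)       ∎
      where open ≤-Reasoning

-- Sequential orderings

module _ {A : Set} where

  ∈-take : ∀ i {xs : List A} {x} → x ∈ₗ List.take i xs → x ∈ₗ xs
  ∈-take (suc i) {_ ∷ _} (here refl) = here refl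
  ∈-take (suc i) {_ ∷ _} (there x∈)  = there (∈-take i x∈)

  take-++ˡ : ∀ i (xs ys : List A) → i ≤ length xs → List.take i (xs ++ ys) ≡ List.take i xs
  take-++ˡ zero    xs       ys _         = refl
  take-++ˡ (suc i) (x ∷ xs) ys (s≤s i≤) = cong (x ∷_) (take-++ˡ i xs ys i≤)

  take-insert : ∀ (xs ys : List A) t i
              → List.take i (xs ++ ys) ≡ List.take i (xs ++ t ∷ ys)
              ⊎ Σ (List A) λ zs → List.take i (xs ++ ys) ≡ xs ++ zs × List.take (suc i) (xs ++ t ∷ ys) ≡ xs ++ t ∷ zs
  take-insert []       ys t i       = inj₂ (List.take i ys , refl , refl)
  take-insert (x ∷ xs) ys t zero    = inj₁ refl
  take-insert (x ∷ xs) ys t (suc i) =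
    Sum.map (cong (x ∷_)) (λ (zs , e , e₁) → zs , cong (x ∷_) e , cong (x ∷_) e₁) (take-insert xs ys t i)

  Unique-shift : ∀ (xs : List A) {t ys} → Unique (xs ++ t ∷ ys) → Unique (t ∷ xs ++ ys)
  Unique-shift []       u = u
  Unique-shift (x ∷ xs) {t} {ys} (x∉ ∷ u) with All-resp-↭ (shift t xs ys) x∉ | Unique-shift xs u
  ... | x≢t ∷ x∉₁ | t∉ ∷ u₁ = ((x≢t ∘ sym) ∷ t∉) ∷ x∉₁ ∷ u₁

  Unique-remove : ∀ (xs : List A) {t ys} → Unique (xs ++ t ∷ ys) → Unique (xs ++ ys)
  Unique-remove xs u with Unique-shift xs u
  ... | _ ∷ u₁ = u₁

module _ {n : ℕ} where

  toSubset-∷ : ∀ x (xs : List (Fin n)) → toSubset (x ∷ xs) ≡ toSubset xs ∪ ⁅ x ⁆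
  toSubset-∷ x xs = updateAt-true x (toSubset xs)
    where
    updateAt-true : ∀ {k} (x : Fin k) X → Vec.updateAt X x (λ _ → true) ≡ X ∪ ⁅ x ⁆
    updateAt-true Fin.zero    (b ∷ X) = cong₂ _∷_ (sym (∨-zeroʳ b)) (sym (∪-identityʳ X))
    updateAt-true (Fin.suc x) (b ∷ X) = cong₂ _∷_ (sym (∨-identityʳ b)) (updateAt-true x X)

  ∈-toSubset⁺ : ∀ {xs : List (Fin n)} {x} → x ∈ₗ xs → x ∈ toSubset xs
  ∈-toSubset⁺ {y ∷ ys} (here refl) rewrite toSubset-∷ y ys = t∈X∪⁅t⁆ (toSubset ys) y
  ∈-toSubset⁺ {y ∷ ys} (there x∈)  rewrite toSubset-∷ y ys = x∈p∪q⁺ (inj₁ (∈-toSubset⁺ x∈))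

  ∈-toSubset⁻ : ∀ {xs : List (Fin n)} {x} → x ∈ toSubset xs → x ∈ₗ xs
  ∈-toSubset⁻ {[]} x∈ = ⊥-elim (∉⊥ x∈)
  ∈-toSubset⁻ {y ∷ ys} x∈ rewrite toSubset-∷ y ys =
    [ there ∘ ∈-toSubset⁻ , here ]′ (∈-∪⁅⁆⁻ (toSubset ys) y x∈)

  toSubset-resp-↭ : {xs ys : List (Fin n)} → xs ↭ ys → toSubset xs ≡ toSubset ys
  toSubset-resp-↭ π =
    ⊆-antisym (∈-toSubset⁺ ∘ ∈-resp-↭ π ∘ ∈-toSubset⁻) (∈-toSubset⁺ ∘ ∈-resp-↭ (↭-sym π) ∘ ∈-toSubset⁻)

  enumeration⇒toSubset≡ : ∀ {xs : List (Fin n)} {X} → (∀ x → x ∈ₗ xs ⇔ x ∈ X) → toSubset xs ≡ X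
  enumeration⇒toSubset≡ enum =
    ⊆-antisym (Equivalence.to (enum _) ∘ ∈-toSubset⁻) (∈-toSubset⁺ ∘ Equivalence.from (enum _))

  toSubset≡⇒enumeration : ∀ {xs : List (Fin n)} {X} → toSubset xs ≡ X → ∀ x → x ∈ₗ xs ⇔ x ∈ X
  toSubset≡⇒enumeration refl x = mk⇔ ∈-toSubset⁺ ∈-toSubset⁻

  toSubset-insert : ∀ (xs : List (Fin n)) {t} ys → toSubset (xs ++ t ∷ ys) ≡ toSubset (xs ++ ys) ∪ ⁅ t ⁆
  toSubset-insert xs {t} ys = trans (toSubset-resp-↭ (shift t xs ys)) (toSubset-∷ t (xs ++ ys))

  enumeration-remove : ∀ {A : Subset n} {t} → t ∉ A → ∀ xs {ys} → Unique (xs ++ t ∷ ys)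
                     → (∀ x → x ∈ₗ xs ++ t ∷ ys ⇔ x ∈ A ∪ ⁅ t ⁆) → ∀ x → x ∈ₗ xs ++ ys ⇔ x ∈ A
  enumeration-remove {A} {t} t∉A xs {ys} unique enum x = mk⇔ to from
    where
    to : x ∈ₗ xs ++ ys → x ∈ A
    to x∈ with ∈-∪⁅⁆⁻ A t (Equivalence.to (enum x) (∈-resp-↭ (↭-sym (shift t xs ys)) (there x∈)))
    ... | inj₁ x∈A  = x∈A
    ... | inj₂ refl with Unique-shift xs unique
    ...   | t∉xs++ys ∷ _ = ⊥-elim (All.lookup t∉xs++ys x∈ refl)
    from : x ∈ A → x ∈ₗ xs ++ ys
    from x∈A with ∈-resp-↭ (shift t xs ys) (Equivalence.from (enum x) (x∈p∪q⁺ (inj₁ x∈A)))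
    ... | here refl = ⊥-elim (t∉A x∈A)
    ... | there x∈  = x∈

module _ {n : ℕ} (G : Graph n) where

  CutRank≤2 : List (Fin n) → Set
  CutRank≤2 xs = cutRank G (toSubset xs) ≤ 2

  Sequential⇒cutRank≤2 : ∀ {A} → Sequential G A → cutRank G A ≤ 2
  Sequential⇒cutRank≤2 {A} ([] , _ , enum , _) = begin
    cutRank G A                  ≤⟨ rk-mono (adj G) {C = outside A} no-rows id ⟩
    rank (length (outside A)) [] ≡⟨ rank-[] (length (outside A)) ⟩
    0                            ≤⟨ z≤n ⟩
    2                            ∎
    where
    open ≤-Reasoning
    no-rows : inside A ⊆ₗ []
    no-rows j∈ = Equivalence.from (enum _) (∈-inside⁻ A j∈)
  Sequential⇒cutRank≤2 {A} (as@(_ ∷ _) , _ , enum , prefix≤2) =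
    subst (λ X → cutRank G X ≤ 2) (enumeration⇒toSubset≡ enum)
          (subst CutRank≤2 (take-all (length as) as ≤-refl) (prefix≤2 (length as) (s≤s z≤n) ≤-refl))

  module _ {A t} (t∉A : t ∉ A) (ρ-eq : cutRank G (A ∪ ⁅ t ⁆) ≡ cutRank G A) where

    Sequential-append : Sequential G A → Sequential G (A ∪ ⁅ t ⁆)
    Sequential-append seq@(as , unique , enum , prefix≤2) =
      as ++ [ t ] , unique₁ , toSubset≡⇒enumeration toSubset-as-t , prefix≤2₁
      where
      unique₁ : Unique (as ++ [ t ])
      unique₁ = Unique-++⁺ unique ([] ∷ []) (λ { (t∈as , here refl) → t∉A (Equivalence.to (enum _) t∈as) })
      toSubset-as-t : toSubset (as ++ [ t ]) ≡ A ∪ ⁅ t ⁆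
      toSubset-as-t = begin
        toSubset (as ++ [ t ])  ≡⟨ toSubset-resp-↭ (∷↭∷ʳ t as) ⟨
        toSubset (t ∷ as)       ≡⟨ toSubset-∷ t as ⟩
        toSubset as ∪ ⁅ t ⁆     ≡⟨ cong (_∪ ⁅ t ⁆) (enumeration⇒toSubset≡ enum) ⟩
        A ∪ ⁅ t ⁆               ∎
        where open ≡-Reasoning
      prefix≤2₁ : ∀ i → 1 ≤ i → i ≤ length (as ++ [ t ]) → CutRank≤2 (List.take i (as ++ [ t ]))
      prefix≤2₁ i 1≤i i≤ with i ≤? length as
      ... | yes i≤as = subst CutRank≤2 (sym (take-++ˡ i as [ t ] i≤as)) (prefix≤2 i 1≤i i≤as)
      ... | no  i≰as = subst CutRank≤2 (sym (take-all i (as ++ [ t ]) everything-taken))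
                         (subst (_≤ 2) (sym (trans (cong (cutRank G) toSubset-as-t) ρ-eq)) (Sequential⇒cutRank≤2 seq))
        where
        everything-taken : length (as ++ [ t ]) ≤ i
        everything-taken = begin
          length (as ++ [ t ]) ≡⟨ length-++ as ⟩
          length as + 1        ≡⟨ +-comm (length as) 1 ⟩
          suc (length as)      ≤⟨ ≰⇒> i≰as ⟩
          i                    ∎
          where open ≤-Reasoning

    Sequential-remove : Sequential G (A ∪ ⁅ t ⁆) → Sequential G A
    Sequential-remove (bs , unique , enum , prefix≤2) with ∈-∃++ (Equivalence.from (enum t) (t∈X∪⁅t⁆ A t))
    ... | xs , ys , refl = xs ++ ys , Unique-remove xs unique , enum₁ , prefix≤2₁
      where
      enum₁ : ∀ x → x ∈ₗ xs ++ ys ⇔ x ∈ A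
      enum₁ = enumeration-remove t∉A xs unique enum

      prefix≤2₁ : ∀ i → 1 ≤ i → i ≤ length (xs ++ ys) → CutRank≤2 (List.take i (xs ++ ys))
      prefix≤2₁ i 1≤i i≤ with take-insert xs ys t i
      ... | inj₁ same-prefix =
        subst CutRank≤2 (sym same-prefix)
              (prefix≤2 i 1≤i (≤-trans i≤ (≤-trans (n≤1+n _) (≤-reflexive (sym (length-++-sucʳ xs t ys))))))
      ... | inj₂ (zs , prefix , prefix₁) = begin
        cutRank G (toSubset (List.take i (xs ++ ys)))           ≡⟨ cong (cutRank G ∘ toSubset) prefix ⟩
        cutRank G (toSubset (xs ++ zs))                         ≤⟨ cutRank-∪⁅⁆-mono G t∉A Y⊆A ρ-eq ⟩
        cutRank G (toSubset (xs ++ zs) ∪ ⁅ t ⁆)                 ≡⟨ cong (cutRank G) (toSubset-insert xs zs) ⟨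
        cutRank G (toSubset (xs ++ t ∷ zs))                     ≡⟨ cong (cutRank G ∘ toSubset) prefix₁ ⟨
        cutRank G (toSubset (List.take (suc i) (xs ++ t ∷ ys))) ≤⟨ prefix≤2 (suc i) (s≤s z≤n) suc-i≤ ⟩
        2                                                       ∎
        where
        open ≤-Reasoning
        Y⊆A : toSubset (xs ++ zs) ⊆ A
        Y⊆A = Equivalence.to (enum₁ _) ∘ ∈-take i ∘ subst (_ ∈ₗ_) (sym prefix) ∘ ∈-toSubset⁻
        suc-i≤ : suc i ≤ length (xs ++ t ∷ ys)
        suc-i≤ = ≤-trans (s≤s i≤) (≤-reflexive (sym (length-++-sucʳ xs t ys)))

lemma3p1 : ∀ {n : ℕ} (G : Graph n) (A : Subset n) (t : Fin n)
             → cutRank G (A ∪ ⁅ t ⁆) ≡ cutRank G A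
             → Sequential G (A ∪ ⁅ t ⁆) ⇔ Sequential G A
lemma3p1 G A t ρ-eq with t ∈? A
... | yes t∈A = mk⇔ (subst (Sequential G) A∪⁅t⁆≡A) (subst (Sequential G) (sym A∪⁅t⁆≡A))
  where
  A∪⁅t⁆≡A : A ∪ ⁅ t ⁆ ≡ A
  A∪⁅t⁆≡A = ⊆-antisym ([ id , (λ { refl → t∈A }) ]′ ∘ ∈-∪⁅⁆⁻ A t) (x∈p∪q⁺ ∘ inj₁)
... | no t∉A = mk⇔ (Sequential-remove G t∉A ρ-eq) (Sequential-append G t∉A ρ-eq)
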